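{- Let $G=G_{A,B}$ be a DSR graph (for some $A\in\mathbb{R}^{n\times m}$, $B\in\mathbb{R}^{m\times n}$) which is steady. Then every nonempty closed walk in $G$ is an s-walk.
   Context: For $A\in\mathbb{R}^{n\times m}$ and $B\in\mathbb{R}^{m\times n}$, the DSR graph $G_{A,B}$ has S-vertices $S_1,\dots,S_n$ and R-vertices $R_1,\dots,R_m$. There is an arc $R_j\to S_i$ iff $A_{ij}\ne0$, with sign $\mathrm{sign}(A_{ij})$, and an arc $S_i\to R_j$ iff $B_{ji}\ne0$, with sign $\mathrm{sign}(B_{ji})$. A pair of antiparallel arcs between $S_i$ and $R_j$ having the same sign is treated as a single undirected edge (traversable in both directions); antiparallel arcs of opposite signs remain two distinct directed edges. An edge arising from a nonzero $A_{ij}$ (directed R-to-S, or undirected) has label $l(e)=|A_{ij}|$; an edge with only S-to-R orientation has label $l(e)=\infty$. A walk is an alternating sequence of vertices and edges, each edge traversed consistently with its orientation, with repetitions allowed; it is closed if its first and last vertices coincide. A cycle is a nonempty closed walk repeating no vertex except first $=$ last (so $(u,v,u)$ is a cycle iff $uv$ and $vu$ are distinct directed edges of opposite signs). A closed walk $(e_1,\dots,e_{2r})$ (listed by edges) is an s-walk if every $e_i$ has finite label and $\prod_{i=1}^r l(e_{2i-1})=\prod_{i=1}^r l(e_{2i})$; an s-cycle is a cycle which is an s-walk. A DSR graph is steady if all its cycles are s-cycles. -}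

module Defs where

open import Level using (0ℓ)
open import Data.Nat as ℕ using (ℕ)
open import Data.Fin using (Fin)
open import Data.List using (List; []; _∷_; map; length)
open import Data.List.Relation.Unary.All using (All)
open import Data.List.Relation.Unary.Unique.Propositional using (Unique)
open import Data.Product using (_×_; ∃)
open import Relation.Nullary using (¬_)
open import Relation.Binary using (Rel; IsStrictTotalOrder; tri<; tri≈; tri>)
open import Relation.Binary.PropositionalEquality using (_≡_; _≢_)
open import Algebra.Structures using (IsCommutativeRing)

-- An ordered field (the real numbers are one).  The paper works over ℝ;
-- agda-stdlib has no reals, so the statement is made for an arbitrary
-- ordered field, which in particular covers ℝ.

record OrderedField : Set₁ where
  infixl 7 _*_
  infixl 6 _+_
  infix 4 _<_
  field
    Carrier : Set
    _+_ _*_ : Carrier → Carrier → Carrier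
    -_ : Carrier → Carrier
    0# 1# : Carrier
    _<_ : Rel Carrier 0ℓ
    isCommutativeRing : IsCommutativeRing _≡_ _+_ _*_ -_ 0# 1#
    isStrictTotalOrder : IsStrictTotalOrder _≡_ _<_
    0≢1 : 0# ≢ 1#
    +-mono-< : ∀ {x y} z → x < y → x + z < y + z
    *-pos : ∀ {x y} → 0# < x → 0# < y → 0# < x * y
    inverse : ∀ x → x ≢ 0# → ∃ λ y → x * y ≡ 1#

  open IsStrictTotalOrder isStrictTotalOrder using (compare)

  data Sign : Set where
    neg zer pos : Sign

  sign : Carrier → Sign
  sign x with compare x 0#
  ... | tri< _ _ _ = neg
  ... | tri≈ _ _ _ = zer
  ... | tri> _ _ _ = pos

  ∣_∣ : Carrier → Carrier
  ∣ x ∣ with compare x 0#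
  ... | tri< _ _ _ = - x
  ... | tri≈ _ _ _ = x
  ... | tri> _ _ _ = x

module DSR (F : OrderedField) {n m : ℕ}
           (A : Fin n → Fin m → OrderedField.Carrier F)
           (B : Fin m → Fin n → OrderedField.Carrier F) where

  open OrderedField F

  data Vertex : Set where
    S : Fin n → Vertex
    R : Fin m → Vertex

  -- potential edges between S_i and R_j:
  --   und i j : the undirected edge (antiparallel arcs of the same sign)
  --   rs  i j : the directed edge R_j → S_i
  --   sr  i j : the directed edge S_i → R_j
  data Edge : Set where
    und rs sr : Fin n → Fin m → Edge

  SameSign : Fin n → Fin m → Set
  SameSign i j = A i j ≢ 0# × B j i ≢ 0# × sign (A i j) ≡ sign (B j i)

  IsEdge : Edge → Set
  IsEdge (und i j) = SameSign i j
  IsEdge (rs i j)  = A i j ≢ 0# × ¬ SameSign i j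
  IsEdge (sr i j)  = B j i ≢ 0# × ¬ SameSign i j

  data Traverses : Edge → Vertex → Vertex → Set where
    und-SR : ∀ {i j} → Traverses (und i j) (S i) (R j)
    und-RS : ∀ {i j} → Traverses (und i j) (R j) (S i)
    rs-RS  : ∀ {i j} → Traverses (rs i j) (R j) (S i)
    sr-SR  : ∀ {i j} → Traverses (sr i j) (S i) (R j)

  data Label : Set where
    fin : Carrier → Label
    ∞   : Label

  label : Edge → Label
  label (und i j) = fin ∣ A i j ∣
  label (rs i j)  = fin ∣ A i j ∣
  label (sr i j)  = ∞

  data IsFinite : Label → Set where
    fin : ∀ x → IsFinite (fin x)

  -- product of labels (∞ absorbing; only used when all labels are finite)
  _·ₗ_ : Label → Label → Label
  fin x ·ₗ fin y = fin (x * y)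
  _     ·ₗ _     = ∞

  prodₗ : List Label → Label
  prodₗ []       = fin 1#
  prodₗ (l ∷ ls) = l ·ₗ prodₗ ls

  data Walk : Vertex → Vertex → Set where
    []  : ∀ {u} → Walk u u
    _∷_ : ∀ {u v w} {e : Edge} → IsEdge e × Traverses e u v → Walk v w → Walk u w

  edges : ∀ {u v} → Walk u v → List Edge
  edges []                    = []
  edges (_∷_ {e = e} _ w)     = e ∷ edges w

  inner : ∀ {u v} → Walk u v → List Vertex
  inner []                    = []
  inner (_∷_ {u = u} _ w)     = u ∷ inner w

  NonEmpty : ∀ {u v} → Walk u v → Set
  NonEmpty w = 0 ℕ.< length (edges w)

  -- odd-indexed (e₁, e₃, …) and even-indexed (e₂, e₄, …) entries
  odds evens : {X : Set} → List X → List X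
  odds []       = []
  odds (x ∷ xs) = x ∷ evens xs
  evens []       = []
  evens (x ∷ xs) = odds xs

  IsSWalk : ∀ {u} → Walk u u → Set
  IsSWalk w = All IsFinite (map label (edges w))
            × prodₗ (map label (odds (edges w))) ≡ prodₗ (map label (evens (edges w)))

  -- cycle: nonempty closed walk repeating no vertex except first = last
  -- (and no edge; this only matters for length-2 cycles (u,v,u), which
  -- must use two distinct directed edges)
  IsCycle : ∀ {u} → Walk u u → Set
  IsCycle w = NonEmpty w × Unique (inner w) × Unique (edges w)

  Steady : Set
  Steady = ∀ {u} (c : Walk u u) → IsCycle c → IsSWalk c

-- Orient the s-walk condition: a closed walk is an s-walk iff the product
-- of the labels of its S→R traversals equals the product of the labels of
-- its R→S traversals (odd and even edges alternate between the two kinds,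
-- and the R→S labels are always finite, so equality also forces
-- finiteness).  This "balance" is multiplicative, hence survives splicing
-- a balanced closed walk into a balanced one, and going back and forth
-- along an (undirected) edge is balanced.  A closed walk that is not a
-- cycle either repeats a vertex, and splits into two shorter closed walks,
-- or repeats an edge in opposite directions, and is a shorter closed walk
-- with such a detour inserted; induction on length reduces everything to
-- cycles, which are balanced by steadiness.

module Submission where

open import Defs
open import Data.Nat using (ℕ)
open import Data.Fin using (Fin)

open import Level using (Level)
open import Algebra.Bundles using (CommutativeMonoid)
open import Algebra.Structures using (IsCommutativeRing; IsCommutativeMonoid)
open import Algebra.Structures.Biased using (isCommutativeMonoidˡ)
import Algebra.Solver.CommutativeMonoid as CommutativeMonoidSolver
open import Data.Nat using (_<_; z<s)
open import Data.Nat.Properties using (+-0-commutativeMonoid; m<m+n; m<n+m; m≤n+m; <-≤-trans)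
open import Data.Nat.Induction using (<-wellFounded)
open import Data.Fin.Properties using () renaming (_≟_ to _≟ᶠ_)
open import Data.List using (List; []; _∷_; map)
open import Data.List.Relation.Unary.All using (All; []; _∷_)
open import Data.List.Relation.Unary.All.Properties using (¬Any⇒All¬)
open import Data.List.Relation.Unary.AllPairs using ([]; _∷_)
open import Data.List.Relation.Unary.Any using (here; there)
open import Data.List.Relation.Unary.Unique.Propositional using (Unique)
open import Data.List.Membership.Propositional using (_∈_)
import Data.List.Membership.DecPropositional as DecMembership
open import Data.Product using (_×_; _,_; proj₁; proj₂; ∃₂; -,_)
open import Data.Sum using (_⊎_; inj₁; inj₂)
open import Induction.WellFounded using (Acc; acc)
open import Relation.Nullary using (yes; no)
open import Relation.Nullary.Decidable using (map′; _×-dec_)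
open import Relation.Binary.Bundles using (Setoid)
open import Relation.Binary.Definitions using (DecidableEquality)
open import Relation.Binary.PropositionalEquality
  using (_≡_; refl; sym; trans; cong; cong₂; subst; isEquivalence)
import Relation.Binary.Reasoning.Setoid as SetoidReasoning

module _ (F : OrderedField) {n m : ℕ}
         (A : Fin n → Fin m → OrderedField.Carrier F)
         (B : Fin m → Fin n → OrderedField.Carrier F) where

  open OrderedField F using (_*_; 1#; isCommutativeRing)
  open IsCommutativeRing isCommutativeRing using (*-assoc; *-comm; *-identityˡ)
  open DSR F A B

  ·ₗ-assoc : ∀ a b c → (a ·ₗ b) ·ₗ c ≡ a ·ₗ (b ·ₗ c)
  ·ₗ-assoc (fin x) (fin y) (fin z) = cong fin (*-assoc x y z)
  ·ₗ-assoc (fin x) (fin y) ∞       = refl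
  ·ₗ-assoc (fin x) ∞       c       = refl
  ·ₗ-assoc ∞       b       c       = refl

  ·ₗ-comm : ∀ a b → a ·ₗ b ≡ b ·ₗ a
  ·ₗ-comm (fin x) (fin y) = cong fin (*-comm x y)
  ·ₗ-comm (fin x) ∞       = refl
  ·ₗ-comm ∞       (fin y) = refl
  ·ₗ-comm ∞       ∞       = refl

  ·ₗ-identityˡ : ∀ a → fin 1# ·ₗ a ≡ a
  ·ₗ-identityˡ (fin x) = cong fin (*-identityˡ x)
  ·ₗ-identityˡ ∞       = refl

  ·ₗ-isCommutativeMonoid : IsCommutativeMonoid _≡_ _·ₗ_ (fin 1#)
  ·ₗ-isCommutativeMonoid = isCommutativeMonoidˡ record
    { isSemigroup = record
      { isMagma = record { isEquivalence = isEquivalence ; ∙-cong = cong₂ _·ₗ_ }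
      ; assoc   = ·ₗ-assoc
      }
    ; identityˡ = ·ₗ-identityˡ
    ; comm      = ·ₗ-comm
    }

  ·ₗ-commutativeMonoid : CommutativeMonoid _ _
  ·ₗ-commutativeMonoid = record { isCommutativeMonoid = ·ₗ-isCommutativeMonoid }

  ·ₗ-finite⁻ : ∀ a b → IsFinite (a ·ₗ b) → IsFinite a × IsFinite b
  ·ₗ-finite⁻ (fin x) (fin y) _ = fin x , fin y

  ·ₗ-finite⁺ : ∀ {a b} → IsFinite a → IsFinite b → IsFinite (a ·ₗ b)
  ·ₗ-finite⁺ (fin x) (fin y) = fin (x * y)

  infixr 5 _++ʷ_
  _++ʷ_ : ∀ {u v w} → Walk u v → Walk v w → Walk u w
  []      ++ʷ q = q
  (s ∷ p) ++ʷ q = s ∷ (p ++ʷ q)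

  module _ {c ℓ : Level} (M : CommutativeMonoid c ℓ) where

    open CommutativeMonoid M using (Carrier; _≈_; _∙_; ε; setoid; ∙-congˡ; assoc; identityˡ)
    open Setoid setoid using () renaming (refl to ≈-refl; sym to ≈-sym; trans to ≈-trans)
    open CommutativeMonoidSolver M using (solve; _⊜_; _⊕_)
    open SetoidReasoning setoid

    weight : (∀ {e x y} → Traverses e x y → Carrier) → ∀ {u v} → Walk u v → Carrier
    weight f []            = ε
    weight f ((_ , t) ∷ w) = f t ∙ weight f w

    module _ (f : ∀ {e x y} → Traverses e x y → Carrier) where

      weight-++ : ∀ {u v w} (p : Walk u v) (q : Walk v w) →
                  weight f (p ++ʷ q) ≈ weight f p ∙ weight f q
      weight-++ []            q = ≈-sym (identityˡ (weight f q))
      weight-++ ((_ , t) ∷ p) q = begin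
        f t ∙ weight f (p ++ʷ q)        ≈⟨ ∙-congˡ (weight-++ p q) ⟩
        f t ∙ (weight f p ∙ weight f q) ≈⟨ ≈-sym (assoc _ _ _) ⟩
        (f t ∙ weight f p) ∙ weight f q ∎

      weight-splice : ∀ {u x v} (p : Walk u x) (c : Walk x x) (q : Walk x v) →
                      weight f (p ++ʷ (c ++ʷ q)) ≈ weight f c ∙ weight f (p ++ʷ q)
      weight-splice p c q = begin
        weight f (p ++ʷ (c ++ʷ q))                ≈⟨ ≈-trans (weight-++ p _) (∙-congˡ (weight-++ c q)) ⟩
        weight f p ∙ (weight f c ∙ weight f q)    ≈⟨ solve 3 (λ P C Q → P ⊕ (C ⊕ Q) ⊜ C ⊕ (P ⊕ Q)) ≈-refl _ _ _ ⟩
        weight f c ∙ (weight f p ∙ weight f q)    ≈⟨ ∙-congˡ (≈-sym (weight-++ p q)) ⟩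
        weight f c ∙ weight f (p ++ʷ q)           ∎

      weight-backtrack : ∀ {u x y v e} (p : Walk u x) (s : IsEdge e × Traverses e x y) (m : Walk y y)
                         (s′ : IsEdge e × Traverses e y x) (q : Walk x v) →
                         weight f (p ++ʷ (s ∷ (m ++ʷ (s′ ∷ q))))
                           ≈ weight f m ∙ ((f (proj₂ s) ∙ f (proj₂ s′)) ∙ weight f (p ++ʷ q))
      weight-backtrack p s m s′ q = begin
        weight f (p ++ʷ (s ∷ (m ++ʷ (s′ ∷ q))))
          ≈⟨ ≈-trans (weight-++ p _) (∙-congˡ (∙-congˡ (weight-++ m _))) ⟩
        weight f p ∙ (f (proj₂ s) ∙ (weight f m ∙ (f (proj₂ s′) ∙ weight f q)))
          ≈⟨ solve 5 (λ P S M S′ Q → P ⊕ (S ⊕ (M ⊕ (S′ ⊕ Q))) ⊜ M ⊕ ((S ⊕ S′) ⊕ (P ⊕ Q)))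
                   ≈-refl _ _ _ _ _ ⟩
        weight f m ∙ ((f (proj₂ s) ∙ f (proj₂ s′)) ∙ (weight f p ∙ weight f q))
          ≈⟨ ∙-congˡ (∙-congˡ (≈-sym (weight-++ p q))) ⟩
        weight f m ∙ ((f (proj₂ s) ∙ f (proj₂ s′)) ∙ weight f (p ++ʷ q)) ∎

  len : ∀ {u v} → Walk u v → ℕ
  len = weight +-0-commutativeMonoid (λ _ → 1)

  labelˢʳ labelʳˢ : ∀ {e x y} → Traverses e x y → Label
  labelˢʳ (und-SR {i} {j}) = label (und i j)
  labelˢʳ (sr-SR {i} {j})  = label (sr i j)
  labelˢʳ und-RS           = fin 1#
  labelˢʳ rs-RS            = fin 1#
  labelʳˢ (und-RS {i} {j}) = label (und i j)
  labelʳˢ (rs-RS {i} {j})  = label (rs i j)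
  labelʳˢ und-SR           = fin 1#
  labelʳˢ sr-SR            = fin 1#

  weightˢʳ weightʳˢ : ∀ {u v} → Walk u v → Label
  weightˢʳ = weight ·ₗ-commutativeMonoid labelˢʳ
  weightʳˢ = weight ·ₗ-commutativeMonoid labelʳˢ

  Balanced : ∀ {u} → Walk u u → Set
  Balanced w = weightˢʳ w ≡ weightʳˢ w

  labelProduct : List Edge → Label
  labelProduct es = prodₗ (map label es)

  odd-even-products-from-S : ∀ {i v} (w : Walk (S i) v) →
                labelProduct (odds (edges w)) ≡ weightˢʳ w × labelProduct (evens (edges w)) ≡ weightʳˢ w
  odd-even-products-from-R : ∀ {j v} (w : Walk (R j) v) →
                labelProduct (odds (edges w)) ≡ weightʳˢ w × labelProduct (evens (edges w)) ≡ weightˢʳ w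
  odd-even-products-from-S [] = refl , refl
  odd-even-products-from-S ((_ , und-SR) ∷ w) =
    cong (_ ·ₗ_) (proj₂ (odd-even-products-from-R w)) , trans (proj₁ (odd-even-products-from-R w)) (sym (·ₗ-identityˡ _))
  odd-even-products-from-S ((_ , sr-SR) ∷ w) =
    refl , trans (proj₁ (odd-even-products-from-R w)) (sym (·ₗ-identityˡ _))
  odd-even-products-from-R [] = refl , refl
  odd-even-products-from-R ((_ , und-RS) ∷ w) =
    cong (_ ·ₗ_) (proj₂ (odd-even-products-from-S w)) , trans (proj₁ (odd-even-products-from-S w)) (sym (·ₗ-identityˡ _))
  odd-even-products-from-R ((_ , rs-RS) ∷ w) =
    cong (_ ·ₗ_) (proj₂ (odd-even-products-from-S w)) , trans (proj₁ (odd-even-products-from-S w)) (sym (·ₗ-identityˡ _))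

  weightʳˢ-finite : ∀ {u v} (w : Walk u v) → IsFinite (weightʳˢ w)
  weightʳˢ-finite []            = fin 1#
  weightʳˢ-finite ((_ , t) ∷ w) = ·ₗ-finite⁺ (labelʳˢ-finite t) (weightʳˢ-finite w)
    where
    labelʳˢ-finite : ∀ {e x y} (t : Traverses e x y) → IsFinite (labelʳˢ t)
    labelʳˢ-finite und-SR = fin 1#
    labelʳˢ-finite und-RS = fin _
    labelʳˢ-finite rs-RS  = fin _
    labelʳˢ-finite sr-SR  = fin 1#

  weightˢʳ-finite⇒labels-finite : ∀ {u v} (w : Walk u v) →
                                  IsFinite (weightˢʳ w) → All IsFinite (map label (edges w))
  weightˢʳ-finite⇒labels-finite []            _   = []
  weightˢʳ-finite⇒labels-finite ((_ , t) ∷ w) fin-tw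
    with ·ₗ-finite⁻ (labelˢʳ t) (weightˢʳ w) fin-tw
  ... | fin-t , fin-w = label-finite t fin-t ∷ weightˢʳ-finite⇒labels-finite w fin-w
    where
    label-finite : ∀ {e x y} (t : Traverses e x y) → IsFinite (labelˢʳ t) → IsFinite (label e)
    label-finite und-SR fin-t = fin-t
    label-finite und-RS _     = fin _
    label-finite rs-RS  _     = fin _
    label-finite sr-SR  ()

  IsSWalk⇒Balanced : ∀ {u} (w : Walk u u) → IsSWalk w → Balanced w
  IsSWalk⇒Balanced {S _} w (_ , odd≡even) =
    trans (sym (proj₁ (odd-even-products-from-S w))) (trans odd≡even (proj₂ (odd-even-products-from-S w)))
  IsSWalk⇒Balanced {R _} w (_ , odd≡even) =
    trans (sym (proj₂ (odd-even-products-from-R w))) (trans (sym odd≡even) (proj₁ (odd-even-products-from-R w)))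

  Balanced⇒IsSWalk : ∀ {u} (w : Walk u u) → Balanced w → IsSWalk w
  Balanced⇒IsSWalk w balanced =
    weightˢʳ-finite⇒labels-finite w (subst IsFinite (sym balanced) (weightʳˢ-finite w)) ,
    odd≡even w balanced
    where
    odd≡even : ∀ {u} (w : Walk u u) → Balanced w →
               labelProduct (odds (edges w)) ≡ labelProduct (evens (edges w))
    odd≡even {S _} w balanced =
      trans (proj₁ (odd-even-products-from-S w)) (trans balanced (sym (proj₂ (odd-even-products-from-S w))))
    odd≡even {R _} w balanced =
      trans (proj₁ (odd-even-products-from-R w)) (trans (sym balanced) (sym (proj₂ (odd-even-products-from-R w))))

  reversal-balanced : ∀ {e x y} (t : Traverses e x y) (t′ : Traverses e y x) →
                      labelˢʳ t ·ₗ labelˢʳ t′ ≡ labelʳˢ t ·ₗ labelʳˢ t′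
  reversal-balanced und-SR und-RS = ·ₗ-comm _ _
  reversal-balanced und-RS und-SR = ·ₗ-comm _ _

  Balanced-splice : ∀ {u x} (p : Walk u x) (c : Walk x x) (q : Walk x u) →
                    Balanced c → Balanced (p ++ʷ q) → Balanced (p ++ʷ (c ++ʷ q))
  Balanced-splice p c q balanced-c balanced-pq =
    trans (weight-splice ·ₗ-commutativeMonoid labelˢʳ p c q)
    (trans (cong₂ _·ₗ_ balanced-c balanced-pq)
    (sym (weight-splice ·ₗ-commutativeMonoid labelʳˢ p c q)))

  Balanced-backtrack : ∀ {u x y e} (p : Walk u x) (s : IsEdge e × Traverses e x y) (m : Walk y y)
                       (s′ : IsEdge e × Traverses e y x) (q : Walk x u) →
                       Balanced m → Balanced (p ++ʷ q) → Balanced (p ++ʷ (s ∷ (m ++ʷ (s′ ∷ q))))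
  Balanced-backtrack p s m s′ q balanced-m balanced-pq =
    trans (weight-backtrack ·ₗ-commutativeMonoid labelˢʳ p s m s′ q)
    (trans (cong₂ _·ₗ_ balanced-m (cong₂ _·ₗ_ (reversal-balanced (proj₂ s) (proj₂ s′)) balanced-pq))
    (sym (weight-backtrack ·ₗ-commutativeMonoid labelʳˢ p s m s′ q)))

  _≟ᵛ_ : DecidableEquality Vertex
  S i ≟ᵛ S i′ = map′ (cong S) (λ { refl → refl }) (i ≟ᶠ i′)
  R j ≟ᵛ R j′ = map′ (cong R) (λ { refl → refl }) (j ≟ᶠ j′)
  S _ ≟ᵛ R _  = no λ ()
  R _ ≟ᵛ S _  = no λ ()

  _≟ᵉ_ : DecidableEquality Edge
  und i j ≟ᵉ und i′ j′ = map′ (λ { (refl , refl) → refl }) (λ { refl → refl , refl }) (i ≟ᶠ i′ ×-dec j ≟ᶠ j′)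
  rs i j  ≟ᵉ rs i′ j′  = map′ (λ { (refl , refl) → refl }) (λ { refl → refl , refl }) (i ≟ᶠ i′ ×-dec j ≟ᶠ j′)
  sr i j  ≟ᵉ sr i′ j′  = map′ (λ { (refl , refl) → refl }) (λ { refl → refl , refl }) (i ≟ᶠ i′ ×-dec j ≟ᶠ j′)
  und _ _ ≟ᵉ rs _ _    = no λ ()
  und _ _ ≟ᵉ sr _ _    = no λ ()
  rs _ _  ≟ᵉ und _ _   = no λ ()
  rs _ _  ≟ᵉ sr _ _    = no λ ()
  sr _ _  ≟ᵉ und _ _   = no λ ()
  sr _ _  ≟ᵉ rs _ _    = no λ ()

  open DecMembership _≟ᵛ_ using () renaming (_∈?_ to _∈ᵛ?_)
  open DecMembership _≟ᵉ_ using () renaming (_∈?_ to _∈ᵉ?_)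

  data Split {u v} : Walk u v → Edge → Vertex → Vertex → Set where
    split : ∀ {e x y} (a : Walk u x) (s : IsEdge e × Traverses e x y) (b : Walk y v) →
            Split (a ++ʷ (s ∷ b)) e x y

  split-at-vertex : ∀ {u v x} (w : Walk u v) → x ∈ inner w → ∃₂ λ e y → Split w e x y
  split-at-vertex (s ∷ w) (here refl) = -, -, split [] s w
  split-at-vertex (s ∷ w) (there x∈w) with split-at-vertex w x∈w
  ... | _ , _ , split a s′ b = -, -, split (s ∷ a) s′ b

  split-at-edge : ∀ {u v e} (w : Walk u v) → e ∈ edges w → ∃₂ λ x y → Split w e x y
  split-at-edge (s ∷ w) (here refl) = -, -, split [] s w
  split-at-edge (s ∷ w) (there e∈w) with split-at-edge w e∈w
  ... | _ , _ , split a s′ b = -, -, split (s ∷ a) s′ b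

  traversals-same-or-reversed : ∀ {e u v x y} → Traverses e u v → Traverses e x y →
                                (x ≡ u × y ≡ v) ⊎ (x ≡ v × y ≡ u)
  traversals-same-or-reversed und-SR und-SR = inj₁ (refl , refl)
  traversals-same-or-reversed und-SR und-RS = inj₂ (refl , refl)
  traversals-same-or-reversed und-RS und-SR = inj₂ (refl , refl)
  traversals-same-or-reversed und-RS und-RS = inj₁ (refl , refl)
  traversals-same-or-reversed rs-RS  rs-RS  = inj₁ (refl , refl)
  traversals-same-or-reversed sr-SR  sr-SR  = inj₁ (refl , refl)

  data Decomposition {u v} : Walk u v → Set where
    simple    : ∀ {w} → Unique (inner w) → Unique (edges w) → Decomposition w
    loop      : ∀ {x} (p : Walk u x) (c : Walk x x) (q : Walk x v) →
                0 < len c → 0 < len (p ++ʷ q) → Decomposition (p ++ʷ (c ++ʷ q))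
    backtrack : ∀ {e x y} (p : Walk u x) (s : IsEdge e × Traverses e x y) (m : Walk y y)
                (s′ : IsEdge e × Traverses e y x) (q : Walk x v) →
                Decomposition (p ++ʷ (s ∷ (m ++ʷ (s′ ∷ q))))

  decompose : ∀ {u v} (w : Walk u v) → Decomposition w
  decompose [] = simple [] []
  decompose (_∷_ {u} {e = e} s w) with u ∈ᵛ? inner w | e ∈ᵉ? edges w
  ... | yes u∈w | _ with split-at-vertex w u∈w
  ...   | _ , _ , split a s′ b = loop [] (s ∷ a) (s′ ∷ b) z<s z<s
  decompose (s ∷ w) | no _ | yes e∈w with split-at-edge w e∈w
  ...   | _ , _ , split a s′ b with traversals-same-or-reversed (proj₂ s) (proj₂ s′)
  ...     | inj₁ (refl , refl) = loop [] (s ∷ a) (s′ ∷ b) z<s z<s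
  ...     | inj₂ (refl , refl) = backtrack [] s a s′ b
  decompose (s ∷ w) | no u∉w | no e∉w with decompose w
  ... | simple uᵛ uᵉ          = simple (¬Any⇒All¬ _ u∉w ∷ uᵛ) (¬Any⇒All¬ _ e∉w ∷ uᵉ)
  ... | loop p c q c⁺ _       = loop (s ∷ p) c q c⁺ z<s
  ... | backtrack p s₁ m s′ q = backtrack (s ∷ p) s₁ m s′ q

  loop-shorterˡ : ∀ {u x v} (p : Walk u x) (c : Walk x x) (q : Walk x v) →
                  0 < len (p ++ʷ q) → len c < len (p ++ʷ (c ++ʷ q))
  loop-shorterˡ p c q pq⁺
    rewrite weight-splice +-0-commutativeMonoid (λ _ → 1) p c q = m<m+n (len c) pq⁺

  loop-shorterʳ : ∀ {u x v} (p : Walk u x) (c : Walk x x) (q : Walk x v) →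
                  0 < len c → len (p ++ʷ q) < len (p ++ʷ (c ++ʷ q))
  loop-shorterʳ p c q c⁺
    rewrite weight-splice +-0-commutativeMonoid (λ _ → 1) p c q = m<n+m (len (p ++ʷ q)) c⁺

  backtrack-shorterˡ : ∀ {u x y v e} (p : Walk u x) (s : IsEdge e × Traverses e x y) (m : Walk y y)
                       (s′ : IsEdge e × Traverses e y x) (q : Walk x v) →
                       len m < len (p ++ʷ (s ∷ (m ++ʷ (s′ ∷ q))))
  backtrack-shorterˡ p s m s′ q
    rewrite weight-backtrack +-0-commutativeMonoid (λ _ → 1) p s m s′ q = m<m+n (len m) z<s

  backtrack-shorterʳ : ∀ {u x y v e} (p : Walk u x) (s : IsEdge e × Traverses e x y) (m : Walk y y)
                       (s′ : IsEdge e × Traverses e y x) (q : Walk x v) →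
                       len (p ++ʷ q) < len (p ++ʷ (s ∷ (m ++ʷ (s′ ∷ q))))
  backtrack-shorterʳ p s m s′ q
    rewrite weight-backtrack +-0-commutativeMonoid (λ _ → 1) p s m s′ q =
    <-≤-trans (m<n+m (len (p ++ʷ q)) z<s) (m≤n+m _ (len m))

  module _ (steady : Steady) where

    simple-closed-walk-balanced : ∀ {u} (w : Walk u u) → Unique (inner w) → Unique (edges w) → Balanced w
    simple-closed-walk-balanced []      _  _  = refl
    simple-closed-walk-balanced (s ∷ w) uᵛ uᵉ = IsSWalk⇒Balanced (s ∷ w) (steady (s ∷ w) (z<s , uᵛ , uᵉ))

    closed-walk-balanced : ∀ {u} (w : Walk u u) → Acc _<_ (len w) → Balanced w
    closed-walk-balanced w (acc shorter) with decompose w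
    ... | simple uᵛ uᵉ = simple-closed-walk-balanced w uᵛ uᵉ
    ... | loop p c q c⁺ pq⁺ =
      Balanced-splice p c q
        (closed-walk-balanced c (shorter (loop-shorterˡ p c q pq⁺)))
        (closed-walk-balanced (p ++ʷ q) (shorter (loop-shorterʳ p c q c⁺)))
    ... | backtrack p s m s′ q =
      Balanced-backtrack p s m s′ q
        (closed-walk-balanced m (shorter (backtrack-shorterˡ p s m s′ q)))
        (closed-walk-balanced (p ++ʷ q) (shorter (backtrack-shorterʳ p s m s′ q)))

lemma2p8 : (F : OrderedField) (n m : ℕ)
           (A : Fin n → Fin m → OrderedField.Carrier F)
           (B : Fin m → Fin n → OrderedField.Carrier F) →
           DSR.Steady F A B →
           ∀ {u} (w : DSR.Walk F A B u u) → DSR.NonEmpty F A B w → DSR.IsSWalk F A B w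
-- The empty walk is an s-walk too.
lemma2p8 F n m A B steady w _ =
  Balanced⇒IsSWalk F A B w (closed-walk-balanced F A B steady w (<-wellFounded _))
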